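{- Let $q$ be an odd prime and let $\mathcal{C}$ be a proper array code (PAC) with modulus $q$ whose parity-check matrix $H$ has column weight $r$. If $r=4$, then the Tanner graph of $\mathcal{C}$ contains a cycle of length six if and only if there exist three distinct block-columns of $H$ whose labels $i,j,k$ satisfy at least one of the congruences $$-2i+j+k \equiv 0 \pmod q, \qquad -3i+j+2k \equiv 0 \pmod q.$$ If $r=3$, then the Tanner graph of $\mathcal{C}$ contains a cycle of length six if and only if there exist three distinct block-columns of $H$ whose labels $i,j,k$ satisfy $-2i+j+k \equiv 0 \pmod q$.
   Context: For integers $a\le b$, $[a,b]$ denotes $\{x\in\mathbb{Z}: a\le x\le b\}$. Let $q$ be an odd prime, let $I$ be the $q\times q$ identity matrix, and let $P$ be a $q\times q$ circulant permutation matrix with $P\neq I$. Given an integer $r\in[1,q]$ and distinct integers $a_0,\dots,a_{r-1}\in[0,q-1]$ (the block-row labels), the array code with modulus $q$ is the binary linear code whose parity-check matrix $H$ is the $rq\times q^2$ matrix made of an $r\times q$ array of $q\times q$ blocks, the block in block-row $i\in[0,r-1]$ and block-column $j\in[0,q-1]$ being $P^{a_i\cdot j}$. Its column weight is $r$. The integer $j$ is the label of the $j$-th block-column. The code is a proper array code (PAC) if $a_0,\dots,a_{r-1}$ form an arithmetic progression with nonzero common difference, i.e. there is an integer $a\neq 0$ with $a_{i+1}-a_i=a$ for all $i\in[0,r-2]$. The Tanner graph of a code with parity-check matrix $H$ is the bipartite graph with one vertex per column and one per row of $H$, a column vertex and a row vertex being adjacent iff the corresponding entry of $H$ is $1$.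 -}

module Defs where

open import Data.Nat using (ℕ; zero; suc; _+_; _*_; _<_; _≤_; NonZero; _%_)
open import Data.Nat.Properties using () renaming (_≟_ to _ℕ≟_)
open import Data.Nat.DivMod using (m%n<n)
open import Data.Fin using (Fin; toℕ; fromℕ<) renaming (zero to fzero; suc to fsuc)
open import Data.Fin.Properties using (_≟_)
open import Data.Integer as ℤ using (ℤ; +_)
open import Data.Integer.Divisibility using () renaming (_∣_ to _∣ℤ_)
open import Data.Product using (Σ; _×_; _,_)
open import Data.Sum using (_⊎_; inj₁; inj₂)
open import Data.Empty using (⊥)
open import Relation.Binary.PropositionalEquality using (_≡_; _≢_)
open import Relation.Nullary using (¬_; yes; no)
open import Function.Definitions using (Injective)

Mat : ℕ → Set
Mat q = Fin q → Fin q → ℕ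

sumFin : ∀ {n} → (Fin n → ℕ) → ℕ
sumFin {zero}  f = 0
sumFin {suc n} f = f fzero + sumFin (λ w → f (fsuc w))

idMat : ∀ {q} → Mat q
idMat u v with u ≟ v
... | yes _ = 1
... | no  _ = 0

_·_ : ∀ {q} → Mat q → Mat q → Mat q
(A · B) u v = sumFin (λ w → A u w * B w v)

_^_ : ∀ {q} → Mat q → ℕ → Mat q
A ^ zero  = idMat
A ^ suc n = A · (A ^ n)

-- The circulant permutation matrix with shift s: entry (u,v) is 1 iff v ≡ u + s (mod q).
-- Every q×q circulant permutation matrix is of this form for a unique s ∈ [0,q-1].
circPerm : (q : ℕ) → Fin q → Mat q
circPerm (suc m) s u v with toℕ v ℕ≟ ((toℕ u + toℕ s) % suc m)
... | yes _ = 1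
... | no  _ = 0

-- a_0,…,a_{r-1} (indexed by ℕ; only indices < r matter) are the block-row labels
-- of a proper array code with modulus q and column weight r.
IsPAC : (q r : ℕ) → (ℕ → ℕ) → Set
IsPAC q r a =
  (1 ≤ r) × (r ≤ q)
  × (∀ i → i < r → a i < q)
  × (∀ i j → i < r → j < r → a i ≡ a j → i ≡ j)
  × Σ ℤ (λ d → (d ≢ + 0) × (∀ i → suc i < r → (+ a (suc i)) ℤ.- (+ a i) ≡ d))

-- Parity-check matrix H of the array code: rows indexed by (block-row i, row u within block),
-- columns by (block-column j, column v within block); block (i,j) is P^(a_i · j).
parityCheck : (q r : ℕ) → (P : Mat q) → (a : ℕ → ℕ) →
              (Fin r × Fin q) → (Fin q × Fin q) → ℕ
parityCheck q r P a (i , u) (j , v) = (P ^ (a (toℕ i) * toℕ j)) u v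

TannerAdj : {R C : Set} → (R → C → ℕ) → (C ⊎ R) → (C ⊎ R) → Set
TannerAdj H (inj₁ c) (inj₂ x) = H x c ≡ 1
TannerAdj H (inj₂ x) (inj₁ c) = H x c ≡ 1
TannerAdj H (inj₁ _) (inj₁ _) = ⊥
TannerAdj H (inj₂ _) (inj₂ _) = ⊥

nextFin : ∀ {m} → Fin (suc m) → Fin (suc m)
nextFin {m} i = fromℕ< (m%n<n (suc (toℕ i)) (suc m))

HasCycle : {V : Set} → (V → V → Set) → (n : ℕ) → Set
HasCycle {V} adj zero    = ⊥
HasCycle {V} adj (suc m) =
  Σ (Fin (suc m) → V) λ f → Injective _≡_ _≡_ f × (∀ t → adj (f t) (f (nextFin t)))

_≡_[mod_] : ℤ → ℤ → ℕ → Set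
x ≡ y [mod q ] = (+ q) ∣ℤ (x ℤ.- y)

module Submission where

-- In the Tanner graph of H a cycle of length six alternates between three columns (jₜ, vₜ)
-- and three rows (bₜ, uₜ), and since every block of H is a permutation matrix the block-rows
-- bₜ and the block-columns jₜ are pairwise distinct.  Row (b, u) meets column (j, v) iff
-- v ≡ u + s·a_b·j (mod q), so the alternating sum of these six congruences eliminates all
-- uₜ and vₜ and leaves s · Σₜ a_{bₜ} (jₜ − jₜ₊₁) ≡ 0; conversely such data is realised by a
-- cycle, choosing u₁ freely and solving for the other vertices.  For a proper array code
-- a_b = a₀ + b·d, and s and d are invertible modulo the prime q, so the condition becomes
-- Σₜ bₜ (jₜ − jₜ₊₁) ≡ 0.  This sum is invariant under rotating the cycle and changes sign
-- when it is reversed, hence one may assume b₁ < b₂ < b₃.  For r = 3 only (0, 1, 2)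
-- remains, and for r = 4 the four increasing triples produce exactly the two congruences.

open import Defs
open import Data.Nat as ℕ using (ℕ; zero; suc; _<_; _%_; z≤n; s≤s; z<s)
import Data.Nat.Properties as ℕ
open import Data.Nat.DivMod using (m%n<n; m<n⇒m%n≡m; %-distribˡ-+; m%n%n≡m%n)
open import Data.Nat.Divisibility using (n∣m⇒m%n≡0) renaming (_∣_ to _∣ℕ_)
open import Data.Nat.Primality using (Prime; euclidsLemma)
open import Algebra.Properties.CommutativeMonoid.Sum ℕ.+-0-commutativeMonoid
  using (sum; sum-remove; sum-cong-≗; sum-replicate-zero)
open import Data.Integer as ℤ using (ℤ; +_; -_; _+_; _-_; _*_)
import Data.Integer.Properties as ℤ
open import Data.Integer.DivMod using (_%ℕ_; _/ℕ_; n%ℕd<d; a≡a%ℕn+[a/ℕn]*n)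
open import Data.Integer.Divisibility.Signed
  using (_∣_; divides; ∣ᵤ⇒∣; ∣⇒∣ᵤ; ∣m∣n⇒∣m+n; ∣m∣n⇒∣m-n; ∣m⇒∣-m; ∣n⇒∣m*n; ∣m+n∣m⇒∣n)
open import Data.Integer.Tactic.RingSolver using (solve-∀)
open import Data.Fin as Fin using (Fin; toℕ; fromℕ<)
open import Data.Fin.Patterns using (0F; 1F; 2F; 3F; 4F; 5F)
import Data.Fin.Properties as Fin
open import Data.Vec using (Vec; []; _∷_; lookup)
open import Data.Vec.Functional using (removeAt)
open import Data.Vec.Relation.Unary.All using ([]; _∷_)
open import Data.Vec.Relation.Unary.AllPairs using ([]; _∷_)
open import Data.Vec.Relation.Unary.Unique.Propositional using (Unique)
open import Data.Vec.Relation.Unary.Unique.Propositional.Properties using (lookup-injective)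
open import Data.Product using (Σ; _×_; _,_; proj₁; proj₂; uncurry)
open import Data.Sum using (_⊎_; inj₁; inj₂)
open import Data.Sum.Properties using (inj₁-injective; inj₂-injective)
open import Data.Empty using (⊥-elim)
open import Function using (_∘_; _⇔_; mk⇔; Equivalence)
open import Function.Construct.Composition using (_⇔-∘_)
open import Function.Definitions using (Injective)
open import Relation.Binary.Definitions using (tri<; tri≈; tri>)
open import Relation.Binary.PropositionalEquality
open import Relation.Nullary using (¬_; yes; no)

Distinct₃ : {A : Set} → A → A → A → Set
Distinct₃ x y z = (x ≢ y) × (y ≢ z) × (x ≢ z)

module _ {A B : Set} (f : A → B) where

  Distinct₃-image : Injective _≡_ _≡_ f → ∀ {x y z} → Distinct₃ x y z → Distinct₃ (f x) (f y) (f z)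
  Distinct₃-image f-injective (x≢y , y≢z , x≢z) = x≢y ∘ f-injective , y≢z ∘ f-injective , x≢z ∘ f-injective

  Distinct₃-preimage : ∀ {x y z} → Distinct₃ (f x) (f y) (f z) → Distinct₃ x y z
  Distinct₃-preimage (fx≢fy , fy≢fz , fx≢fz) = fx≢fy ∘ cong f , fy≢fz ∘ cong f , fx≢fz ∘ cong f

Distinct₃-rotate : {A : Set} {x y z : A} → Distinct₃ x y z → Distinct₃ y z x
Distinct₃-rotate (x≢y , y≢z , x≢z) = y≢z , x≢z ∘ sym , x≢y ∘ sym

Distinct₃-swap : {A : Set} {x y z : A} → Distinct₃ x y z → Distinct₃ x z y
Distinct₃-swap (x≢y , y≢z , x≢z) = x≢z , y≢z ∘ sym , x≢y

-- Six-cycles in a Tanner graph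

module _ {R C : Set} (H : R → C → ℕ) where

  record Hexagon : Set where
    constructor hexagon
    field
      c₁ c₂ c₃ : C
      x₁ x₂ x₃ : R
      distinct-c : Distinct₃ c₁ c₂ c₃
      distinct-x : Distinct₃ x₁ x₂ x₃
      x₁c₁ : H x₁ c₁ ≡ 1
      x₁c₂ : H x₁ c₂ ≡ 1
      x₂c₂ : H x₂ c₂ ≡ 1
      x₂c₃ : H x₂ c₃ ≡ 1
      x₃c₃ : H x₃ c₃ ≡ 1
      x₃c₁ : H x₃ c₁ ≡ 1

  private
    Adj = TannerAdj H

  hexagon⇒cycle : Hexagon → HasCycle Adj 6
  hexagon⇒cycle (hexagon c₁ c₂ c₃ x₁ x₂ x₃ (c₁≢c₂ , c₂≢c₃ , c₁≢c₃) (x₁≢x₂ , x₂≢x₃ , x₁≢x₃)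
                         x₁c₁ x₁c₂ x₂c₂ x₂c₃ x₃c₃ x₃c₁) =
    lookup vertices , (λ {i} {j} → lookup-injective unique i j) , edge
    where
      vertices : Vec (C ⊎ R) 6
      vertices = inj₁ c₁ ∷ inj₂ x₁ ∷ inj₁ c₂ ∷ inj₂ x₂ ∷ inj₁ c₃ ∷ inj₂ x₃ ∷ []

      unique : Unique vertices
      unique = ((λ ()) ∷ c₁≢c₂ ∘ inj₁-injective ∷ (λ ()) ∷ c₁≢c₃ ∘ inj₁-injective ∷ (λ ()) ∷ [])
             ∷ ((λ ()) ∷ x₁≢x₂ ∘ inj₂-injective ∷ (λ ()) ∷ x₁≢x₃ ∘ inj₂-injective ∷ [])
             ∷ ((λ ()) ∷ c₂≢c₃ ∘ inj₁-injective ∷ (λ ()) ∷ [])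
             ∷ ((λ ()) ∷ x₂≢x₃ ∘ inj₂-injective ∷ [])
             ∷ ((λ ()) ∷ [])
             ∷ [] ∷ []

      edge : ∀ t → Adj (lookup vertices t) (lookup vertices (nextFin t))
      edge 0F = x₁c₁
      edge 1F = x₁c₂
      edge 2F = x₂c₂
      edge 3F = x₂c₃
      edge 4F = x₃c₃
      edge 5F = x₃c₁

  private
    alternating : ∀ w₀ w₁ w₂ w₃ w₄ w₅ →
                  Adj w₀ w₁ → Adj w₁ w₂ → Adj w₂ w₃ → Adj w₃ w₄ → Adj w₄ w₅ → Adj w₅ w₀ →
                  Distinct₃ w₀ w₂ w₄ → Distinct₃ w₁ w₃ w₅ → Hexagon
    alternating (inj₁ c₁) (inj₂ x₁) (inj₁ c₂) (inj₂ x₂) (inj₁ c₃) (inj₂ x₃) e₀ e₁ e₂ e₃ e₄ e₅ dc dx =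
      hexagon c₁ c₂ c₃ x₁ x₂ x₃ (Distinct₃-preimage inj₁ dc) (Distinct₃-preimage inj₂ dx) e₀ e₁ e₂ e₃ e₄ e₅
    alternating (inj₂ x₃) (inj₁ c₁) (inj₂ x₁) (inj₁ c₂) (inj₂ x₂) (inj₁ c₃) e₀ e₁ e₂ e₃ e₄ e₅ dx dc =
      hexagon c₁ c₂ c₃ x₁ x₂ x₃ (Distinct₃-preimage inj₁ dc) (Distinct₃-rotate (Distinct₃-preimage inj₂ dx))
              e₁ e₂ e₃ e₄ e₅ e₀
    alternating (inj₁ _) (inj₁ _) _ _ _ _ () _ _ _ _ _ _ _
    alternating (inj₂ _) (inj₂ _) _ _ _ _ () _ _ _ _ _ _ _
    alternating _ (inj₁ _) (inj₁ _) _ _ _ _ () _ _ _ _ _ _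
    alternating _ (inj₂ _) (inj₂ _) _ _ _ _ () _ _ _ _ _ _
    alternating _ _ (inj₁ _) (inj₁ _) _ _ _ _ () _ _ _ _ _
    alternating _ _ (inj₂ _) (inj₂ _) _ _ _ _ () _ _ _ _ _
    alternating _ _ _ (inj₁ _) (inj₁ _) _ _ _ _ () _ _ _ _
    alternating _ _ _ (inj₂ _) (inj₂ _) _ _ _ _ () _ _ _ _
    alternating _ _ _ _ (inj₁ _) (inj₁ _) _ _ _ _ () _ _ _
    alternating _ _ _ _ (inj₂ _) (inj₂ _) _ _ _ _ () _ _ _

  cycle⇒hexagon : HasCycle Adj 6 → Hexagon
  cycle⇒hexagon (f , f-injective , edge) =
    alternating (f 0F) (f 1F) (f 2F) (f 3F) (f 4F) (f 5F)
                (edge 0F) (edge 1F) (edge 2F) (edge 3F) (edge 4F) (edge 5F)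
                (Distinct₃-image f f-injective ((λ ()) , (λ ()) , (λ ())))
                (Distinct₃-image f f-injective ((λ ()) , (λ ()) , (λ ())))

  cycle⇔hexagon : HasCycle Adj 6 ⇔ Hexagon
  cycle⇔hexagon = mk⇔ cycle⇒hexagon hexagon⇒cycle

-- Powers of a circulant permutation matrix

δ : ℕ → ℕ → ℕ
δ x y with x ℕ.≟ y
... | yes _ = 1
... | no  _ = 0

δ-≡ : ∀ {x y} → x ≡ y → δ x y ≡ 1
δ-≡ {x} {y} x≡y with x ℕ.≟ y
... | yes _   = refl
... | no x≢y = ⊥-elim (x≢y x≡y)

δ-≢ : ∀ {x y} → x ≢ y → δ x y ≡ 0
δ-≢ {x} {y} x≢y with x ℕ.≟ y
... | yes x≡y = ⊥-elim (x≢y x≡y)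
... | no _    = refl

δ≡1⇒≡ : ∀ {x y} → δ x y ≡ 1 → x ≡ y
δ≡1⇒≡ {x} {y} δ≡1 with x ℕ.≟ y
... | yes x≡y = x≡y

sumFin≡sum : ∀ {n} (f : Fin n → ℕ) → sumFin f ≡ sum f
sumFin≡sum {zero}  f = refl
sumFin≡sum {suc n} f = cong (f Fin.zero ℕ.+_) (sumFin≡sum (f ∘ Fin.suc))

sumFin-single : ∀ {n} (f : Fin n → ℕ) (w₀ : Fin n) → (∀ w → w ≢ w₀ → f w ≡ 0) → sumFin f ≡ f w₀
sumFin-single {suc n} f w₀ f≡0 = begin
  sumFin f                      ≡⟨ sumFin≡sum f ⟩
  sum f                         ≡⟨ sum-remove {i = w₀} f ⟩
  f w₀ ℕ.+ sum (removeAt f w₀)  ≡⟨ cong (f w₀ ℕ.+_) (sum-cong-≗ {n} (λ k → f≡0 _ (Fin.punchInᵢ≢i w₀ k))) ⟩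
  f w₀ ℕ.+ sum {n} (λ _ → 0)    ≡⟨ cong (f w₀ ℕ.+_) (sum-replicate-zero n) ⟩
  f w₀ ℕ.+ 0                    ≡⟨ ℕ.+-identityʳ (f w₀) ⟩
  f w₀                          ∎
  where open ≡-Reasoning

module Circulant (m : ℕ) where

  q : ℕ
  q = suc m

  shift : ℕ → Mat q
  shift k u v = δ (toℕ v) ((toℕ u ℕ.+ k) % q)

  circPerm≡shift : ∀ s u v → circPerm q s u v ≡ shift (toℕ s) u v
  circPerm≡shift s u v with toℕ v ℕ.≟ ((toℕ u ℕ.+ toℕ s) % q)
  ... | yes _ = refl
  ... | no  _ = refl

  [u+0]%q≡u : ∀ (u : Fin q) → (toℕ u ℕ.+ 0) % q ≡ toℕ u
  [u+0]%q≡u u = trans (cong (_% q) (ℕ.+-identityʳ (toℕ u))) (m<n⇒m%n≡m (Fin.toℕ<n u))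

  idMat≡shift : ∀ u v → idMat u v ≡ shift 0 u v
  idMat≡shift u v with u Fin.≟ v
  ... | yes refl = sym (δ-≡ (sym ([u+0]%q≡u u)))
  ... | no u≢v  = sym (δ-≢ (λ v≡ → u≢v (Fin.toℕ-injective (sym (trans v≡ ([u+0]%q≡u u))))))

  [m%q+n]%q≡[m+n]%q : ∀ x y → (x % q ℕ.+ y) % q ≡ (x ℕ.+ y) % q
  [m%q+n]%q≡[m+n]%q x y = begin
    (x % q ℕ.+ y) % q             ≡⟨ %-distribˡ-+ (x % q) y q ⟩
    (x % q % q ℕ.+ y % q) % q     ≡⟨ cong (λ t → (t ℕ.+ y % q) % q) (m%n%n≡m%n x q) ⟩
    (x % q ℕ.+ y % q) % q         ≡⟨ %-distribˡ-+ x y q ⟨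
    (x ℕ.+ y) % q                 ∎
    where open ≡-Reasoning

  shift-shift : ∀ k l {u w} v → toℕ w ≡ (toℕ u ℕ.+ k) % q → shift l w v ≡ shift (k ℕ.+ l) u v
  shift-shift k l {u} {w} v w≡ = cong (δ (toℕ v)) (begin
    (toℕ w ℕ.+ l) % q                  ≡⟨ cong (λ t → (t ℕ.+ l) % q) w≡ ⟩
    ((toℕ u ℕ.+ k) % q ℕ.+ l) % q      ≡⟨ [m%q+n]%q≡[m+n]%q (toℕ u ℕ.+ k) l ⟩
    (toℕ u ℕ.+ k ℕ.+ l) % q            ≡⟨ cong (_% q) (ℕ.+-assoc (toℕ u) k l) ⟩
    (toℕ u ℕ.+ (k ℕ.+ l)) % q          ∎)
    where open ≡-Reasoning

  circPerm-^ : ∀ s n u v → (circPerm q s ^ n) u v ≡ shift (n ℕ.* toℕ s) u v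
  circPerm-^ s zero    u v = idMat≡shift u v
  circPerm-^ s (suc n) u v = begin
    sumFin (λ w → P u w ℕ.* (P ^ n) w v)   ≡⟨ sumFin-single _ w₀ off-w₀ ⟩
    P u w₀ ℕ.* (P ^ n) w₀ v                ≡⟨ cong₂ ℕ._*_ (trans (circPerm≡shift s u w₀) (δ-≡ toℕw₀))
                                                          (circPerm-^ s n w₀ v) ⟩
    1 ℕ.* shift (n ℕ.* toℕ s) w₀ v         ≡⟨ ℕ.*-identityˡ _ ⟩
    shift (n ℕ.* toℕ s) w₀ v               ≡⟨ shift-shift (toℕ s) (n ℕ.* toℕ s) {u} v toℕw₀ ⟩
    shift (toℕ s ℕ.+ n ℕ.* toℕ s) u v      ∎
    where
      open ≡-Reasoning
      P = circPerm q s
      w₀ = fromℕ< (m%n<n (toℕ u ℕ.+ toℕ s) q)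
      toℕw₀ : toℕ w₀ ≡ (toℕ u ℕ.+ toℕ s) % q
      toℕw₀ = Fin.toℕ-fromℕ< _
      off-w₀ : ∀ w → w ≢ w₀ → P u w ℕ.* (P ^ n) w v ≡ 0
      off-w₀ w w≢w₀ rewrite circPerm≡shift s u w
                          | δ-≢ (λ e → w≢w₀ (Fin.toℕ-injective (trans e (sym toℕw₀)))) = refl

module _ {q : ℕ} where

  ≡0[mod]⇒∣ : ∀ {x} → x ≡ + 0 [mod q ] → + q ∣ x
  ≡0[mod]⇒∣ {x} x≡0 = subst (+ q ∣_) (ℤ.+-identityʳ x) (∣ᵤ⇒∣ x≡0)

  ∣⇒≡0[mod] : ∀ {x} → + q ∣ x → x ≡ + 0 [mod q ]
  ∣⇒≡0[mod] {x} q∣x = ∣⇒∣ᵤ (subst (+ q ∣_) (sym (ℤ.+-identityʳ x)) q∣x)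

  prime-∣-* : Prime q → ∀ x y → + q ∣ x * y → + q ∣ x ⊎ + q ∣ y
  prime-∣-* q-prime x y q∣xy
    with euclidsLemma ℤ.∣ x ∣ ℤ.∣ y ∣ q-prime (subst (q ∣ℕ_) (ℤ.abs-* x y) (∣⇒∣ᵤ q∣xy))
  ... | inj₁ q∣x = inj₁ (∣ᵤ⇒∣ q∣x)
  ... | inj₂ q∣y = inj₂ (∣ᵤ⇒∣ q∣y)

  ∣-cancel-unit : Prime q → ∀ {c x} → ¬ + q ∣ c → + q ∣ c * x ⇔ + q ∣ x
  ∣-cancel-unit q-prime {c} {x} q∤c = mk⇔ cancel (∣n⇒∣m*n c)
    where
      cancel : + q ∣ c * x → + q ∣ x
      cancel q∣cx with prime-∣-* q-prime c x q∣cx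
      ... | inj₁ q∣c = ⊥-elim (q∤c q∣c)
      ... | inj₂ q∣x = q∣x

module Residues (m : ℕ) where

  private
    q : ℕ
    q = suc m

  %ℕ-∣ : ∀ t → + q ∣ + (t %ℕ q) - t
  %ℕ-∣ t = divides (- (t /ℕ q)) (begin
    + (t %ℕ q) - t                             ≡⟨ cong (λ x → + (t %ℕ q) - x) (a≡a%ℕn+[a/ℕn]*n t q) ⟩
    + (t %ℕ q) - (+ (t %ℕ q) + t /ℕ q * + q)   ≡⟨ ring (+ (t %ℕ q)) (t /ℕ q) (+ q) ⟩
    - (t /ℕ q) * + q                           ∎)
    where
      open ≡-Reasoning
      ring : ∀ r k n → r - (r + k * n) ≡ - k * n
      ring = solve-∀

  residue : ℤ → Fin q
  residue t = fromℕ< (n%ℕd<d t q)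

  residue-∣ : ∀ t → + q ∣ + toℕ (residue t) - t
  residue-∣ t = subst (λ x → + q ∣ + x - t) (sym (Fin.toℕ-fromℕ< (n%ℕd<d t q))) (%ℕ-∣ t)

  ∣-difference⇒≡ : ∀ {x y} → x ℕ.< q → y ℕ.< q → + q ∣ + x - + y → x ≡ y
  ∣-difference⇒≡ {x} {y} x<q y<q q∣x-y =
    ℤ.+-injective (ℤ.i-j≡0⇒i≡j (+ x) (+ y) (ℤ.∣i∣≡0⇒i≡0 ∣x-y∣≡0))
    where
      ∣x-y∣<q : ℤ.∣ + x - + y ∣ ℕ.< q
      ∣x-y∣<q = subst (ℕ._< q) (cong ℤ.∣_∣ (sym (ℤ.m-n≡m⊖n x y)))
                       (ℕ.≤-<-trans (ℤ.∣m⊝n∣≤m⊔n x y) (ℕ.⊔-lub x<q y<q))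
      ∣x-y∣≡0 : ℤ.∣ + x - + y ∣ ≡ 0
      ∣x-y∣≡0 = trans (sym (m<n⇒m%n≡m ∣x-y∣<q)) (n∣m⇒m%n≡0 _ q (∣⇒∣ᵤ q∣x-y))

  ≡%⇔∣ : ∀ {y} x → y ℕ.< q → y ≡ x % q ⇔ + q ∣ + y - + x
  ≡%⇔∣ {y} x y<q = mk⇔ (λ { refl → %ℕ-∣ (+ x) }) from
    where
      ring : ∀ a b c → (a - b) - (c - b) ≡ a - c
      ring = solve-∀
      from : + q ∣ + y - + x → y ≡ x % q
      from q∣y-x = ∣-difference⇒≡ y<q (m%n<n x q)
        (subst (+ q ∣_) (ring (+ y) (+ x) (+ (x % q))) (∣m∣n⇒∣m-n q∣y-x (%ℕ-∣ (+ x))))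

-- Row bₜ of a six-cycle joins the columns jₜ and jₜ₊₁.
cycleSum : ℤ → ℤ → ℤ → ℤ → ℤ → ℤ → ℤ
cycleSum w₁ w₂ w₃ j₁ j₂ j₃ = w₁ * (j₁ - j₂) + w₂ * (j₂ - j₃) + w₃ * (j₃ - j₁)

cycleSum-rotate : ∀ w₁ w₂ w₃ j₁ j₂ j₃ → cycleSum w₂ w₃ w₁ j₂ j₃ j₁ ≡ cycleSum w₁ w₂ w₃ j₁ j₂ j₃
cycleSum-rotate w₁ w₂ w₃ j₁ j₂ j₃ = trans (ℤ.+-comm (t₂ + t₃) t₁) (sym (ℤ.+-assoc t₁ t₂ t₃))
  where t₁ = w₁ * (j₁ - j₂); t₂ = w₂ * (j₂ - j₃); t₃ = w₃ * (j₃ - j₁)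

-- solve-∀ does not unfold definitions, so ring identities are proved in expanded form.
cycleSum-reverse : ∀ w₁ w₂ w₃ j₁ j₂ j₃ → cycleSum w₃ w₂ w₁ j₁ j₃ j₂ ≡ - cycleSum w₁ w₂ w₃ j₁ j₂ j₃
cycleSum-reverse = ring
  where
    ring : ∀ w₁ w₂ w₃ j₁ j₂ j₃ → w₃ * (j₁ - j₃) + w₂ * (j₃ - j₂) + w₁ * (j₂ - j₁)
                                 ≡ - (w₁ * (j₁ - j₂) + w₂ * (j₂ - j₃) + w₃ * (j₃ - j₁))
    ring = solve-∀

cycleSum-affine : ∀ c α d ℓ₁ ℓ₂ ℓ₃ j₁ j₂ j₃ →
  cycleSum (c * (α + d * ℓ₁)) (c * (α + d * ℓ₂)) (c * (α + d * ℓ₃)) j₁ j₂ j₃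
    ≡ c * (d * cycleSum ℓ₁ ℓ₂ ℓ₃ j₁ j₂ j₃)
cycleSum-affine = ring
  where
    ring : ∀ c α d ℓ₁ ℓ₂ ℓ₃ j₁ j₂ j₃ →
      c * (α + d * ℓ₁) * (j₁ - j₂) + c * (α + d * ℓ₂) * (j₂ - j₃) + c * (α + d * ℓ₃) * (j₃ - j₁)
        ≡ c * (d * (ℓ₁ * (j₁ - j₂) + ℓ₂ * (j₂ - j₃) + ℓ₃ * (j₃ - j₁)))
    ring = solve-∀

cycleSum-cong : ∀ {w₁ w₁' w₂ w₂' w₃ w₃'} j₁ j₂ j₃ → w₁ ≡ w₁' → w₂ ≡ w₂' → w₃ ≡ w₃' →
                cycleSum w₁ w₂ w₃ j₁ j₂ j₃ ≡ cycleSum w₁' w₂' w₃' j₁ j₂ j₃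
cycleSum-cong _ _ _ refl refl refl = refl

record Closing (q r : ℕ) (w : Fin r → ℤ) : Set where
  constructor closing
  field
    b₁ b₂ b₃ : Fin r
    j₁ j₂ j₃ : Fin q
    distinct-b : Distinct₃ b₁ b₂ b₃
    distinct-j : Distinct₃ j₁ j₂ j₃
    closes : + q ∣ cycleSum (w b₁) (w b₂) (w b₃) (+ toℕ j₁) (+ toℕ j₂) (+ toℕ j₃)

module _ {q r : ℕ} where

  Closing-map : {w w' : Fin r → ℤ} →
    (∀ b₁ b₂ b₃ j₁ j₂ j₃ → + q ∣ cycleSum (w b₁) (w b₂) (w b₃) j₁ j₂ j₃
                         → + q ∣ cycleSum (w' b₁) (w' b₂) (w' b₃) j₁ j₂ j₃) →
    Closing q r w → Closing q r w'
  Closing-map f (closing b₁ b₂ b₃ j₁ j₂ j₃ db dj cl) =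
    closing b₁ b₂ b₃ j₁ j₂ j₃ db dj (f b₁ b₂ b₃ (+ toℕ j₁) (+ toℕ j₂) (+ toℕ j₃) cl)

  Closing-cong : {w w' : Fin r → ℤ} →
    (∀ b₁ b₂ b₃ j₁ j₂ j₃ → + q ∣ cycleSum (w b₁) (w b₂) (w b₃) j₁ j₂ j₃
                         ⇔ + q ∣ cycleSum (w' b₁) (w' b₂) (w' b₃) j₁ j₂ j₃) →
    Closing q r w ⇔ Closing q r w'
  Closing-cong closes⇔ = mk⇔ (Closing-map λ b₁ b₂ b₃ j₁ j₂ j₃ → Equivalence.to   (closes⇔ b₁ b₂ b₃ j₁ j₂ j₃))
                             (Closing-map λ b₁ b₂ b₃ j₁ j₂ j₃ → Equivalence.from (closes⇔ b₁ b₂ b₃ j₁ j₂ j₃))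

module _ {q r : ℕ} {w : Fin r → ℤ} where

  open Closing

  rotate : Closing q r w → Closing q r w
  rotate (closing b₁ b₂ b₃ j₁ j₂ j₃ db dj cl) =
    closing b₂ b₃ b₁ j₂ j₃ j₁ (Distinct₃-rotate db) (Distinct₃-rotate dj)
            (subst (+ q ∣_) (sym (cycleSum-rotate (w b₁) (w b₂) (w b₃) (+ toℕ j₁) (+ toℕ j₂) (+ toℕ j₃))) cl)

  reverse : Closing q r w → Closing q r w
  reverse (closing b₁ b₂ b₃ j₁ j₂ j₃ db dj cl) =
    closing b₃ b₂ b₁ j₁ j₃ j₂ (Distinct₃-rotate (Distinct₃-swap db)) (Distinct₃-swap dj)
            (subst (+ q ∣_) (sym (cycleSum-reverse (w b₁) (w b₂) (w b₃) (+ toℕ j₁) (+ toℕ j₂) (+ toℕ j₃)))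
                   (∣m⇒∣-m cl))

  Increasing : Closing q r w → Set
  Increasing c = b₁ c Fin.< b₂ c × b₂ c Fin.< b₃ c

  sort : Closing q r w → Σ (Closing q r w) Increasing
  sort c with Fin.<-cmp (b₁ c) (b₂ c) | Fin.<-cmp (b₂ c) (b₃ c) | Fin.<-cmp (b₁ c) (b₃ c)
  ... | tri< 1<2 _ _ | tri< 2<3 _ _ | _            = c , 1<2 , 2<3
  ... | tri< 1<2 _ _ | tri> _ _ 3<2 | tri< 1<3 _ _ = rotate (rotate (reverse c)) , 1<3 , 3<2
  ... | tri< 1<2 _ _ | tri> _ _ 3<2 | tri> _ _ 3<1 = rotate (rotate c) , 3<1 , 1<2
  ... | tri> _ _ 2<1 | tri> _ _ 3<2 | _            = reverse c , 3<2 , 2<1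
  ... | tri> _ _ 2<1 | tri< 2<3 _ _ | tri< 1<3 _ _ = rotate (reverse c) , 2<1 , 1<3
  ... | tri> _ _ 2<1 | tri< 2<3 _ _ | tri> _ _ 3<1 = rotate c , 2<3 , 3<1
  ... | tri≈ _ 1≡2 _ | _            | _            = ⊥-elim (proj₁ (distinct-b c) 1≡2)
  ... | _            | tri≈ _ 2≡3 _ | _            = ⊥-elim (proj₁ (proj₂ (distinct-b c)) 2≡3)
  ... | _            | _            | tri≈ _ 1≡3 _ = ⊥-elim (proj₂ (proj₂ (distinct-b c)) 1≡3)

-- Array codes

misfit : ℤ → ℤ → ℤ → ℤ → ℤ
misfit u w j v = v - (u + w * j)

misfit-alternating-sum : ∀ u₁ u₂ u₃ v₁ v₂ v₃ w₁ w₂ w₃ j₁ j₂ j₃ →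
  - misfit u₁ w₁ j₁ v₁ + misfit u₁ w₁ j₂ v₂ - misfit u₂ w₂ j₂ v₂
    + misfit u₂ w₂ j₃ v₃ - misfit u₃ w₃ j₃ v₃ + misfit u₃ w₃ j₁ v₁
  ≡ cycleSum w₁ w₂ w₃ j₁ j₂ j₃
misfit-alternating-sum = ring
  where
    ring : ∀ u₁ u₂ u₃ v₁ v₂ v₃ w₁ w₂ w₃ j₁ j₂ j₃ →
      - (v₁ - (u₁ + w₁ * j₁)) + (v₂ - (u₁ + w₁ * j₂)) - (v₂ - (u₂ + w₂ * j₂))
        + (v₃ - (u₂ + w₂ * j₃)) - (v₃ - (u₃ + w₃ * j₃)) + (v₁ - (u₃ + w₃ * j₁))
      ≡ w₁ * (j₁ - j₂) + w₂ * (j₂ - j₃) + w₃ * (j₃ - j₁)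
    ring = solve-∀

module ArrayCode (m : ℕ) (s : Fin (suc m)) (r : ℕ) (a : ℕ → ℕ) where

  open Circulant m
  open Residues m

  Row Col : Set
  Row = Fin r × Fin q
  Col = Fin q × Fin q

  H : Row → Col → ℕ
  H = parityCheck q r (circPerm q s) a

  weight : Fin r → ℤ
  weight b = + toℕ s * + a (toℕ b)

  mismatch : Row → Col → ℤ
  mismatch (b , u) (j , v) = misfit (+ toℕ u) (weight b) (+ toℕ j) (+ toℕ v)

  private
    +-shift : ∀ (b : Fin r) (u j : Fin q) →
              + (toℕ u ℕ.+ a (toℕ b) ℕ.* toℕ j ℕ.* toℕ s) ≡ + toℕ u + weight b * + toℕ j
    +-shift b u j = trans (ℤ.pos-+ (toℕ u) _) (cong (λ t → + toℕ u + t) (begin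
      + (a (toℕ b) ℕ.* toℕ j ℕ.* toℕ s)     ≡⟨ ℤ.pos-* (a (toℕ b) ℕ.* toℕ j) (toℕ s) ⟩
      + (a (toℕ b) ℕ.* toℕ j) * + toℕ s     ≡⟨ cong (_* (+ toℕ s)) (ℤ.pos-* (a (toℕ b)) (toℕ j)) ⟩
      + a (toℕ b) * + toℕ j * + toℕ s       ≡⟨ ring (+ a (toℕ b)) (+ toℕ j) (+ toℕ s) ⟩
      weight b * + toℕ j                    ∎))
      where
        open ≡-Reasoning
        ring : ∀ x y z → x * y * z ≡ z * x * y
        ring = solve-∀

  H≡1⇔ : ∀ x c → H x c ≡ 1 ⇔ + q ∣ mismatch x c
  H≡1⇔ (b , u) (j , v) = mk⇔
      (λ H≡1 → subst (λ t → + q ∣ + toℕ v - t) (+-shift b u j) (to (δ≡1⇒≡ (trans (sym H≡shift) H≡1))))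
      (λ q∣ → trans H≡shift (δ-≡ (from (subst (λ t → + q ∣ + toℕ v - t) (sym (+-shift b u j)) q∣))))
    where
      H≡shift = circPerm-^ s (a (toℕ b) ℕ.* toℕ j) u v
      open Equivalence (≡%⇔∣ (toℕ u ℕ.+ a (toℕ b) ℕ.* toℕ j ℕ.* toℕ s) (Fin.toℕ<n v))

  private
    adjacent⇒∣ : ∀ {x c} → H x c ≡ 1 → + q ∣ mismatch x c
    adjacent⇒∣ = Equivalence.to (H≡1⇔ _ _)

    ∣⇒adjacent : ∀ {x c} → + q ∣ mismatch x c → H x c ≡ 1
    ∣⇒adjacent = Equivalence.from (H≡1⇔ _ _)

  same-block-row : ∀ {b b' u u' c} → H (b , u) c ≡ 1 → H (b' , u') c ≡ 1 → b ≡ b' → (b , u) ≡ (b' , u')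
  same-block-row {b} {u = u} {u'} {j , v} h h' refl =
    cong (b ,_) (Fin.toℕ-injective (∣-difference⇒≡ (Fin.toℕ<n u) (Fin.toℕ<n u')
      (subst (+ q ∣_) (ring (+ toℕ v) (+ toℕ u) (+ toℕ u') (weight b * + toℕ j))
             (∣m∣n⇒∣m-n (adjacent⇒∣ h') (adjacent⇒∣ h)))))
    where
      ring : ∀ v u u' X → (v - (u' + X)) - (v - (u + X)) ≡ u - u'
      ring = solve-∀

  same-block-column : ∀ {x j j' v v'} → H x (j , v) ≡ 1 → H x (j' , v') ≡ 1 → j ≡ j' → (j , v) ≡ (j' , v')
  same-block-column {b , u} {j} {v = v} {v'} h h' refl =
    cong (j ,_) (Fin.toℕ-injective (∣-difference⇒≡ (Fin.toℕ<n v) (Fin.toℕ<n v')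
      (subst (+ q ∣_) (ring (+ toℕ v) (+ toℕ v') (+ toℕ u + weight b * + toℕ j))
             (∣m∣n⇒∣m-n (adjacent⇒∣ h) (adjacent⇒∣ h')))))
    where
      ring : ∀ v v' X → (v - X) - (v' - X) ≡ v - v'
      ring = solve-∀

  hexagon⇒closing : Hexagon H → Closing q r weight
  hexagon⇒closing (hexagon (j₁ , v₁) (j₂ , v₂) (j₃ , v₃) (b₁ , u₁) (b₂ , u₂) (b₃ , u₃)
                           (c₁≢c₂ , c₂≢c₃ , c₁≢c₃) (x₁≢x₂ , x₂≢x₃ , x₁≢x₃) e₁₁ e₁₂ e₂₂ e₂₃ e₃₃ e₃₁) =
    closing b₁ b₂ b₃ j₁ j₂ j₃
      (x₁≢x₂ ∘ same-block-row e₁₂ e₂₂ , x₂≢x₃ ∘ same-block-row e₂₃ e₃₃ , x₁≢x₃ ∘ same-block-row e₁₁ e₃₁)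
      (c₁≢c₂ ∘ same-block-column e₁₁ e₁₂ , c₂≢c₃ ∘ same-block-column e₂₂ e₂₃ ,
       c₁≢c₃ ∘ same-block-column e₃₁ e₃₃)
      (subst (+ q ∣_) (misfit-alternating-sum (+ toℕ u₁) (+ toℕ u₂) (+ toℕ u₃) (+ toℕ v₁) (+ toℕ v₂)
                         (+ toℕ v₃) (weight b₁) (weight b₂) (weight b₃) (+ toℕ j₁) (+ toℕ j₂) (+ toℕ j₃))
        (∣m∣n⇒∣m+n (∣m∣n⇒∣m-n (∣m∣n⇒∣m+n (∣m∣n⇒∣m-n (∣m∣n⇒∣m+n (∣m⇒∣-m (adjacent⇒∣ e₁₁))
          (adjacent⇒∣ e₁₂)) (adjacent⇒∣ e₂₂)) (adjacent⇒∣ e₂₃)) (adjacent⇒∣ e₃₃)) (adjacent⇒∣ e₃₁)))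

  closing⇒hexagon : Closing q r weight → Hexagon H
  closing⇒hexagon (closing b₁ b₂ b₃ j₁ j₂ j₃ db dj cl) =
    hexagon (j₁ , v₁) (j₂ , v₂) (j₃ , v₃) (b₁ , u₁) (b₂ , u₂) (b₃ , u₃)
            (Distinct₃-preimage proj₁ dj) (Distinct₃-preimage proj₁ db)
            (∣⇒adjacent q∣e₁₁) (∣⇒adjacent q∣e₁₂) (∣⇒adjacent q∣e₂₂)
            (∣⇒adjacent q∣e₂₃) (∣⇒adjacent q∣e₃₃) (∣⇒adjacent q∣e₃₁)
    where
      W : Fin r → Fin q → ℤ
      W b j = weight b * + toℕ j

      u₁ v₁ v₂ u₂ v₃ u₃ : Fin q
      u₁ = Fin.zero
      v₁ = residue (+ toℕ u₁ + W b₁ j₁)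
      v₂ = residue (+ toℕ u₁ + W b₁ j₂)
      u₂ = residue (+ toℕ v₂ - W b₂ j₂)
      v₃ = residue (+ toℕ u₂ + W b₂ j₃)
      u₃ = residue (+ toℕ v₃ - W b₃ j₃)

      row-residue : ∀ v b j → + q ∣ + toℕ v - (+ toℕ (residue (+ toℕ v - W b j)) + W b j)
      row-residue v b j = subst (+ q ∣_) (ring (+ toℕ (residue (+ toℕ v - W b j))) (+ toℕ v) (W b j))
                                (∣m⇒∣-m (residue-∣ (+ toℕ v - W b j)))
        where
          ring : ∀ u v X → - (u - (v - X)) ≡ v - (u + X)
          ring = solve-∀

      q∣e₁₁ = residue-∣ (+ toℕ u₁ + W b₁ j₁)
      q∣e₁₂ = residue-∣ (+ toℕ u₁ + W b₁ j₂)
      q∣e₂₂ = row-residue v₂ b₂ j₂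
      q∣e₂₃ = residue-∣ (+ toℕ u₂ + W b₂ j₃)
      q∣e₃₃ = row-residue v₃ b₃ j₃
      q∣e₃₁ : + q ∣ mismatch (b₃ , u₃) (j₁ , v₁)
      q∣e₃₁ = ∣m+n∣m⇒∣n
        (subst (+ q ∣_) (sym (misfit-alternating-sum (+ toℕ u₁) (+ toℕ u₂) (+ toℕ u₃) (+ toℕ v₁) (+ toℕ v₂)
                                (+ toℕ v₃) (weight b₁) (weight b₂) (weight b₃) (+ toℕ j₁) (+ toℕ j₂) (+ toℕ j₃)))
                cl)
        (∣m∣n⇒∣m-n (∣m∣n⇒∣m+n (∣m∣n⇒∣m-n (∣m∣n⇒∣m+n (∣m⇒∣-m q∣e₁₁) q∣e₁₂) q∣e₂₂) q∣e₂₃) q∣e₃₃)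

  cycle⇔closing : HasCycle (TannerAdj H) 6 ⇔ Closing q r weight
  cycle⇔closing = mk⇔ hexagon⇒closing closing⇒hexagon ⇔-∘ cycle⇔hexagon H

label : ∀ {r} → Fin r → ℤ
label b = + toℕ b

arithmetic-progression : ∀ {r} {a : ℕ → ℕ} {d} → (∀ i → suc i < r → + a (suc i) - + a i ≡ d) →
                         ∀ i → i < r → + a i ≡ + a 0 + d * + i
arithmetic-progression {a = a} {d} step zero    _     = ring (+ a 0) d
  where
    ring : ∀ α d → α ≡ α + d * + 0
    ring = solve-∀
arithmetic-progression {a = a} {d} step (suc i) i+1<r = begin
  + a (suc i)                   ≡⟨ ring₁ (+ a (suc i)) (+ a i) ⟩
  + a i + (+ a (suc i) - + a i) ≡⟨ cong₂ _+_ (arithmetic-progression {a = a} step i i<r) (step i i+1<r) ⟩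
  + a 0 + d * + i + d           ≡⟨ ring₂ (+ a 0) d (+ i) ⟩
  + a 0 + d * (+ 1 + + i)       ≡⟨ cong (λ t → + a 0 + d * t) (sym (ℤ.pos-+ 1 i)) ⟩
  + a 0 + d * + suc i           ∎
  where
    open ≡-Reasoning
    ring₁ : ∀ x y → x ≡ y + (x - y)
    ring₁ = solve-∀
    ring₂ : ∀ α d i → α + d * i + d ≡ α + d * (+ 1 + i)
    ring₂ = solve-∀
    i<r = ℕ.<-trans (ℕ.n<1+n i) i+1<r

module ProperArrayCode {m : ℕ} (q-prime : Prime (suc m)) {s : Fin (suc m)}
                       (s≢I : ¬ (∀ u v → circPerm (suc m) s u v ≡ idMat u v))
                       {r : ℕ} {a : ℕ → ℕ} (a<q : ∀ i → i < r → a i < suc m)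
                       (a-injective : ∀ i j → i < r → j < r → a i ≡ a j → i ≡ j)
                       {d : ℤ} (step : ∀ i → suc i < r → + a (suc i) - + a i ≡ d) (1<r : 1 < r) where

  open Circulant m using (q; shift; circPerm≡shift; idMat≡shift)
  open Residues m using (∣-difference⇒≡)
  open ArrayCode m s r a using (H; weight; cycle⇔closing)

  q∤s : ¬ + q ∣ + toℕ s
  q∤s q∣s = s≢I λ u v →
    trans (circPerm≡shift s u v) (trans (cong (λ k → shift k u v) s≡0) (sym (idMat≡shift u v)))
    where
      s≡0 : toℕ s ≡ 0
      s≡0 = ∣-difference⇒≡ (Fin.toℕ<n s) z<s (subst (+ q ∣_) (sym (ℤ.+-identityʳ (+ toℕ s))) q∣s)

  private
    0<r : 0 < r
    0<r = ℕ.<-trans z<s 1<r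

  q∤d : ¬ + q ∣ d
  q∤d q∣d with a-injective 1 0 1<r 0<r
                 (∣-difference⇒≡ (a<q 1 1<r) (a<q 0 0<r) (subst (+ q ∣_) (sym (step 0 1<r)) q∣d))
  ... | ()

  weight≡affine : ∀ b → weight b ≡ + toℕ s * (+ a 0 + d * label b)
  weight≡affine b = cong (+ toℕ s *_) (arithmetic-progression {a = a} step (toℕ b) (Fin.toℕ<n b))

  weight-closes⇔label-closes : ∀ b₁ b₂ b₃ j₁ j₂ j₃ →
    + q ∣ cycleSum (weight b₁) (weight b₂) (weight b₃) j₁ j₂ j₃
      ⇔ + q ∣ cycleSum (label b₁) (label b₂) (label b₃) j₁ j₂ j₃
  weight-closes⇔label-closes b₁ b₂ b₃ j₁ j₂ j₃ =
    ∣-cancel-unit q-prime q∤d ⇔-∘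
      (∣-cancel-unit q-prime q∤s ⇔-∘ mk⇔ (subst (+ q ∣_) eq) (subst (+ q ∣_) (sym eq)))
    where
      eq : cycleSum (weight b₁) (weight b₂) (weight b₃) j₁ j₂ j₃
           ≡ + toℕ s * (d * cycleSum (label b₁) (label b₂) (label b₃) j₁ j₂ j₃)
      eq = trans (cycleSum-cong j₁ j₂ j₃ (weight≡affine b₁) (weight≡affine b₂) (weight≡affine b₃))
                 (cycleSum-affine (+ toℕ s) (+ a 0) d (label b₁) (label b₂) (label b₃) j₁ j₂ j₃)

  cycle⇔labelClosing : HasCycle (TannerAdj H) 6 ⇔ Closing q r label
  cycle⇔labelClosing = Closing-cong weight-closes⇔label-closes ⇔-∘ cycle⇔closing

-- Column weights three and four

cycleSum-012 : ∀ x y z → cycleSum (+ 0) (+ 1) (+ 2) x y z ≡ - (+ 2 * x) + y + z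
cycleSum-012 = ring
  where
    ring : ∀ x y z → + 0 * (x - y) + + 1 * (y - z) + + 2 * (z - x) ≡ - (+ 2 * x) + y + z
    ring = solve-∀

cycleSum-123 : ∀ x y z → cycleSum (+ 1) (+ 2) (+ 3) x y z ≡ - (+ 2 * x) + y + z
cycleSum-123 = ring
  where
    ring : ∀ x y z → + 1 * (x - y) + + 2 * (y - z) + + 3 * (z - x) ≡ - (+ 2 * x) + y + z
    ring = solve-∀

cycleSum-013 : ∀ x y z → cycleSum (+ 0) (+ 1) (+ 3) x y z ≡ - (+ 3 * x) + y + + 2 * z
cycleSum-013 = ring
  where
    ring : ∀ x y z → + 0 * (x - y) + + 1 * (y - z) + + 3 * (z - x) ≡ - (+ 3 * x) + y + + 2 * z
    ring = solve-∀

cycleSum-023 : ∀ x y z → cycleSum (+ 0) (+ 2) (+ 3) x y z ≡ - (+ 3 * x) + z + + 2 * y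
cycleSum-023 = ring
  where
    ring : ∀ x y z → + 0 * (x - y) + + 2 * (y - z) + + 3 * (z - x) ≡ - (+ 3 * x) + z + + 2 * y
    ring = solve-∀

module _ {q : ℕ} where

  Midpoint TwoThirdsPoint : Fin q → Fin q → Fin q → Set
  Midpoint       i j k = ((- (+ 2 * + toℕ i)) + + toℕ j + + toℕ k) ≡ + 0 [mod q ]
  TwoThirdsPoint i j k = ((- (+ 3 * + toℕ i)) + + toℕ j + + 2 * + toℕ k) ≡ + 0 [mod q ]

  MidpointTriple MidpointOrTwoThirdsTriple : Set
  MidpointTriple =
    Σ (Fin q) λ i → Σ (Fin q) λ j → Σ (Fin q) λ k → (i ≢ j) × (j ≢ k) × (i ≢ k) × Midpoint i j k
  MidpointOrTwoThirdsTriple =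
    Σ (Fin q) λ i → Σ (Fin q) λ j → Σ (Fin q) λ k → (i ≢ j) × (j ≢ k) × (i ≢ k) ×
      (Midpoint i j k ⊎ TwoThirdsPoint i j k)

  private
    closes-as : ∀ {t t'} → t ≡ t' → + q ∣ t → t' ≡ + 0 [mod q ]
    closes-as t≡t' q∣t = ∣⇒≡0[mod] (subst (+ q ∣_) t≡t' q∣t)

    closes-from : ∀ {t t'} → t ≡ t' → t' ≡ + 0 [mod q ] → + q ∣ t
    closes-from t≡t' t'≡0 = subst (+ q ∣_) (sym t≡t') (≡0[mod]⇒∣ t'≡0)

  increasing⇒midpointTriple : (c : Closing q 3 label) → Increasing c → MidpointTriple
  increasing⇒midpointTriple (closing 0F 1F 2F i j k _ (i≢j , j≢k , i≢k) cl) _ =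
    i , j , k , i≢j , j≢k , i≢k , closes-as (cycleSum-012 (label i) (label j) (label k)) cl
  increasing⇒midpointTriple (closing _  0F _  _ _ _ _ _ _) (() , _)
  increasing⇒midpointTriple (closing 1F 1F _  _ _ _ _ _ _) (s≤s () , _)
  increasing⇒midpointTriple (closing 2F 1F _  _ _ _ _ _ _) (s≤s () , _)
  increasing⇒midpointTriple (closing _  _  0F _ _ _ _ _ _) (_ , ())
  increasing⇒midpointTriple (closing _  1F 1F _ _ _ _ _ _) (_ , s≤s ())
  increasing⇒midpointTriple (closing _  2F 1F _ _ _ _ _ _) (_ , s≤s ())
  increasing⇒midpointTriple (closing _  2F 2F _ _ _ _ _ _) (_ , s≤s (s≤s ()))

  midpointTriple⇒closing : MidpointTriple → Closing q 3 label
  midpointTriple⇒closing (i , j , k , i≢j , j≢k , i≢k , mid) =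
    closing 0F 1F 2F i j k ((λ ()) , (λ ()) , (λ ())) (i≢j , j≢k , i≢k)
      (closes-from (cycleSum-012 (label i) (label j) (label k)) mid)

  increasing⇒midpointOrTwoThirdsTriple : (c : Closing q 4 label) → Increasing c → MidpointOrTwoThirdsTriple
  increasing⇒midpointOrTwoThirdsTriple (closing 0F 1F 2F i j k _ (i≢j , j≢k , i≢k) cl) _ =
    i , j , k , i≢j , j≢k , i≢k , inj₁ (closes-as (cycleSum-012 (label i) (label j) (label k)) cl)
  increasing⇒midpointOrTwoThirdsTriple (closing 1F 2F 3F i j k _ (i≢j , j≢k , i≢k) cl) _ =
    i , j , k , i≢j , j≢k , i≢k , inj₁ (closes-as (cycleSum-123 (label i) (label j) (label k)) cl)
  increasing⇒midpointOrTwoThirdsTriple (closing 0F 1F 3F i j k _ (i≢j , j≢k , i≢k) cl) _ =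
    i , j , k , i≢j , j≢k , i≢k , inj₂ (closes-as (cycleSum-013 (label i) (label j) (label k)) cl)
  increasing⇒midpointOrTwoThirdsTriple (closing 0F 2F 3F i j k _ (i≢j , j≢k , i≢k) cl) _ =
    i , k , j , i≢k , j≢k ∘ sym , i≢j , inj₂ (closes-as (cycleSum-023 (label i) (label j) (label k)) cl)
  increasing⇒midpointOrTwoThirdsTriple (closing _  0F _  _ _ _ _ _ _) (() , _)
  increasing⇒midpointOrTwoThirdsTriple (closing 1F 1F _  _ _ _ _ _ _) (s≤s () , _)
  increasing⇒midpointOrTwoThirdsTriple (closing 2F 1F _  _ _ _ _ _ _) (s≤s () , _)
  increasing⇒midpointOrTwoThirdsTriple (closing 3F 1F _  _ _ _ _ _ _) (s≤s () , _)
  increasing⇒midpointOrTwoThirdsTriple (closing 2F 2F _  _ _ _ _ _ _) (s≤s (s≤s ()) , _)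
  increasing⇒midpointOrTwoThirdsTriple (closing 3F 2F _  _ _ _ _ _ _) (s≤s (s≤s ()) , _)
  increasing⇒midpointOrTwoThirdsTriple (closing _  _  0F _ _ _ _ _ _) (_ , ())
  increasing⇒midpointOrTwoThirdsTriple (closing _  1F 1F _ _ _ _ _ _) (_ , s≤s ())
  increasing⇒midpointOrTwoThirdsTriple (closing _  2F 1F _ _ _ _ _ _) (_ , s≤s ())
  increasing⇒midpointOrTwoThirdsTriple (closing _  2F 2F _ _ _ _ _ _) (_ , s≤s (s≤s ()))
  increasing⇒midpointOrTwoThirdsTriple (closing _  3F 1F _ _ _ _ _ _) (_ , s≤s ())
  increasing⇒midpointOrTwoThirdsTriple (closing _  3F 2F _ _ _ _ _ _) (_ , s≤s (s≤s ()))
  increasing⇒midpointOrTwoThirdsTriple (closing _  3F 3F _ _ _ _ _ _) (_ , s≤s (s≤s (s≤s ())))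

  midpointOrTwoThirdsTriple⇒closing : MidpointOrTwoThirdsTriple → Closing q 4 label
  midpointOrTwoThirdsTriple⇒closing (i , j , k , i≢j , j≢k , i≢k , inj₁ mid) =
    closing 0F 1F 2F i j k ((λ ()) , (λ ()) , (λ ())) (i≢j , j≢k , i≢k)
      (closes-from (cycleSum-012 (label i) (label j) (label k)) mid)
  midpointOrTwoThirdsTriple⇒closing (i , j , k , i≢j , j≢k , i≢k , inj₂ two) =
    closing 0F 1F 3F i j k ((λ ()) , (λ ()) , (λ ())) (i≢j , j≢k , i≢k)
      (closes-from (cycleSum-013 (label i) (label j) (label k)) two)

  closing⇔midpointTriple : Closing q 3 label ⇔ MidpointTriple
  closing⇔midpointTriple = mk⇔ (uncurry increasing⇒midpointTriple ∘ sort) midpointTriple⇒closing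

  closing⇔midpointOrTwoThirdsTriple : Closing q 4 label ⇔ MidpointOrTwoThirdsTriple
  closing⇔midpointOrTwoThirdsTriple =
    mk⇔ (uncurry increasing⇒midpointOrTwoThirdsTriple ∘ sort) midpointOrTwoThirdsTriple⇒closing

theorem2 : (q : ℕ) → Prime q → q % 2 ≡ 1 →
    (s : Fin q) → ¬ (∀ u v → circPerm q s u v ≡ idMat u v) →
    (r : ℕ) → (a : ℕ → ℕ) → IsPAC q r a →
    (r ≡ 4 →
      (HasCycle (TannerAdj (parityCheck q r (circPerm q s) a)) 6
        ⇔ Σ (Fin q) λ i → Σ (Fin q) λ j → Σ (Fin q) λ k →
            (i ≢ j) × (j ≢ k) × (i ≢ k) ×
            ((((- (+ 2 * + toℕ i)) + + toℕ j + + toℕ k) ≡ + 0 [mod q ])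
             ⊎ (((- (+ 3 * + toℕ i)) + + toℕ j + + 2 * + toℕ k) ≡ + 0 [mod q ]))))
    × (r ≡ 3 →
      (HasCycle (TannerAdj (parityCheck q r (circPerm q s) a)) 6
        ⇔ Σ (Fin q) λ i → Σ (Fin q) λ j → Σ (Fin q) λ k →
            (i ≢ j) × (j ≢ k) × (i ≢ k) ×
            (((- (+ 2 * + toℕ i)) + + toℕ j + + toℕ k) ≡ + 0 [mod q ])))
theorem2 zero _ _ ()
theorem2 (suc m) q-prime _ s s≢I r a (_ , _ , a<q , a-injective , d , _ , step) =
    (λ { refl → closing⇔midpointOrTwoThirdsTriple ⇔-∘ cycle⇔labelClosing (s≤s (s≤s z≤n)) })
  , (λ { refl → closing⇔midpointTriple ⇔-∘ cycle⇔labelClosing (s≤s (s≤s z≤n)) })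
  where open ProperArrayCode q-prime s≢I a<q a-injective step
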